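{- Let $L$ be a frame and let $X$ be the set of atoms of $L$. Then $L$ is atomic if and only if $L$ is order-isomorphic to the powerset $\mathrm{Pow}(X)$.
   Context: Work constructively (intuitionistic logic, no choice). $\Omega=\mathrm{Pow}(1)$, with $1=\{0\}$, is the lattice of truth values. For a poset $(L,\leq)$, an element $a\in L$ is an atom if the poset ${\downarrow a}=\{x\in L\mid x\leq a\}$ is order-isomorphic to $\Omega$. $L$ is atomic if for every $x\in L$ the join of all atoms below $x$ exists and equals $x$. -}

module Defs where

open import Level using (Level; _⊔_; suc; Setω)
open import Data.Unit.Polymorphic using (⊤)
open import Data.Product using (Σ; _×_; _,_; proj₁; proj₂)
open import Function using (id; _∘_)
open import Relation.Binary.Bundles using (Poset; Setoid)
open import Relation.Binary.Structures using (IsPartialOrder; IsPreorder; IsEquivalence)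
open import Relation.Binary.Morphism.Structures using (IsOrderIsomorphism)
import Relation.Binary.PropositionalEquality as PE

private variable c ℓ r c₁ ℓ₁ : Level

Subset : (S : Setoid c₁ ℓ₁) (p : Level) → Set (c₁ ⊔ ℓ₁ ⊔ suc p)
Subset S p = Σ (Setoid.Carrier S → Set p)
               (λ U → ∀ {x y} → Setoid._≈_ S x y → U x → U y)

Incl : (S : Setoid c₁ ℓ₁) (p : Level) → Subset S p → Subset S p → Set (c₁ ⊔ p)
Incl S p U V = ∀ x → proj₁ U x → proj₁ V x

SameElems : (S : Setoid c₁ ℓ₁) (p : Level) → Subset S p → Subset S p → Set (c₁ ⊔ p)
SameElems S p U V = Incl S p U V × Incl S p V U

Pow : (S : Setoid c₁ ℓ₁) (p : Level) → Poset (c₁ ⊔ ℓ₁ ⊔ suc p) (c₁ ⊔ p) (c₁ ⊔ p)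
Pow S p = record
  { Carrier = Subset S p
  ; _≈_ = SameElems S p
  ; _≤_ = Incl S p
  ; isPartialOrder = record
    { isPreorder = record
      { isEquivalence = record
        { refl = (λ x u → u) , (λ x u → u)
        ; sym = λ (f , g) → g , f
        ; trans = λ (f , g) (h , k) → (λ x u → h x (f x u)) , (λ x u → g x (k x u))
        }
      ; reflexive = proj₁
      ; trans = λ f g x u → g x (f x u)
      }
    ; antisym = _,_
    }
  }

𝟙 : Setoid Level.zero Level.zero
𝟙 = PE.setoid (⊤ {Level.zero})

Ω : (p : Level) → Poset (suc p) p p
Ω p = Pow 𝟙 p

OrderIsomorphic : ∀ {a b ℓa ℓb ra rb} → Poset a ℓa ra → Poset b ℓb rb → Set _
OrderIsomorphic P Q =
  Σ (Poset.Carrier P → Poset.Carrier Q)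
    (IsOrderIsomorphism (Poset._≈_ P) (Poset._≈_ Q) (Poset._≤_ P) (Poset._≤_ Q))

module _ (L : Poset c ℓ r) where
  open Poset L

  ↓ : Carrier → Poset (c ⊔ r) ℓ r
  ↓ a = record
    { Carrier = Σ Carrier (λ x → x ≤ a)
    ; _≈_ = λ x y → proj₁ x ≈ proj₁ y
    ; _≤_ = λ x y → proj₁ x ≤ proj₁ y
    ; isPartialOrder = record
      { isPreorder = record
        { isEquivalence = record
          { refl = Eq.refl ; sym = Eq.sym ; trans = Eq.trans }
        ; reflexive = reflexive
        ; trans = trans
        }
      ; antisym = antisym
      }
    }

  IsAtom : Carrier → Set (c ⊔ ℓ ⊔ suc r)
  IsAtom a = OrderIsomorphic (↓ a) (Ω r)

  Atoms : Setoid (c ⊔ ℓ ⊔ suc r) ℓ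
  Atoms = record
    { Carrier = Σ Carrier IsAtom
    ; _≈_ = λ x y → proj₁ x ≈ proj₁ y
    ; isEquivalence = record { refl = Eq.refl ; sym = Eq.sym ; trans = Eq.trans }
    }

  IsJoin : ∀ {q} → (Carrier → Set q) → Carrier → Set (c ⊔ r ⊔ q)
  IsJoin P x = (∀ a → P a → a ≤ x)
             × (∀ y → (∀ a → P a → a ≤ y) → x ≤ y)

  Atomic : Set (c ⊔ ℓ ⊔ suc r)
  Atomic = ∀ x → IsJoin (λ a → IsAtom a × a ≤ x) x

record IsFrame (L : Poset c ℓ r) : Setω where
  open Poset L
  infixr 7 _∧_
  field
    _∧_     : Carrier → Carrier → Carrier
    ∧-lb₁   : ∀ x y → (x ∧ y) ≤ x
    ∧-lb₂   : ∀ x y → (x ∧ y) ≤ y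
    ∧-glb   : ∀ x y z → z ≤ x → z ≤ y → z ≤ (x ∧ y)
    ⋁       : ∀ {i} {I : Set i} → (I → Carrier) → Carrier
    ⋁-ub    : ∀ {i} {I : Set i} (f : I → Carrier) (j : I) → f j ≤ ⋁ f
    ⋁-least : ∀ {i} {I : Set i} (f : I → Carrier) (y : Carrier)
              → (∀ j → f j ≤ y) → ⋁ f ≤ y
    distrib : ∀ {i} {I : Set i} (x : Carrier) (f : I → Carrier)
              → (x ∧ ⋁ f) ≈ ⋁ (λ j → x ∧ f j)

module Submission where

-- The proof rests on a concrete reading of "↓a ≅ Ω": through such an
-- isomorphism the truth value of x ≤ a is the proposition a ≤ x, so every
-- truth value is realised by some x ≤ a, and x ≤ z holds as soon as
-- a ≤ x implies a ≤ z.  From this we get that atoms are minimal among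
-- atoms, and (using distributivity of the frame) that an atom below the
-- join of a set U of atoms belongs to U.
--
-- (⇒) Send x to the set of atoms below x.  Atomicity makes this map
--     order-reflecting, and U ↦ ⋁ U is a preimage of every U.
-- (⇐) Singletons are atoms of a powerset and atoms are reflected by order
--     isomorphisms, so the preimage z of the singleton {C} of an atom C
--     lying in the image of x is an atom below x; hence any upper bound y
--     of the atoms below x satisfies z ≤ y, i.e. C lies in the image of y.

open import Defs
open import Level using (Level; _⊔_; lift)
open import Relation.Binary.Bundles using (Poset; Setoid)
open import Function.Bundles using (_⇔_; mk⇔)
open import Data.Product using (Σ; _×_; _,_; proj₁; proj₂)
open import Data.Unit.Polymorphic using (⊤; tt)
open import Relation.Binary.Morphism.Structures using (IsOrderIsomorphism)
import Relation.Binary.Morphism.Construct.Composition as Compose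

private variable c ℓ r c′ ℓ′ r′ p : Level

-- Reading an isomorphism ↓a ≅ Ω p: the truth value attached to x ≤ a is
-- equivalent to a ≤ x.
module DownsetTruthValues (L : Poset c ℓ r) {a : Poset.Carrier L}
                          (iso : OrderIsomorphic (↓ L a) (Ω p)) where
  open Poset L
  open IsOrderIsomorphism (proj₂ iso)

  holds : Σ Carrier (λ x → x ≤ a) → Set p
  holds x = proj₁ (proj₁ iso x) tt

  top : Σ Carrier (λ x → x ≤ a)
  top = a , refl

  holds-top : holds top
  holds-top with surjective ((λ _ → ⊤) , λ _ u → u)
  ... | z , z↦⊤ = mono {z} {top} (proj₂ z) tt (proj₂ (z↦⊤ {z} Eq.refl) tt (lift _))

  holds⇒above : (x : Σ Carrier (λ x → x ≤ a)) → holds x → a ≤ proj₁ x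
  holds⇒above x hx = cancel {top} {x} (λ _ _ → hx)

  realise : (P : Set p) → Σ (Σ Carrier (λ x → x ≤ a))
                            (λ y → (a ≤ proj₁ y → P) × (P → a ≤ proj₁ y))
  realise P with surjective ((λ _ → P) , λ _ u → u)
  ... | y , y↦P = y , (λ a≤y → proj₁ (y↦P {y} Eq.refl) tt (mono {top} {y} a≤y tt holds-top))
                    , (λ pf → cancel {top} {y} (λ t _ → proj₂ (y↦P {y} Eq.refl) t pf))

  reflect : (x z : Σ Carrier (λ x → x ≤ a)) → (a ≤ proj₁ x → a ≤ proj₁ z) → proj₁ x ≤ proj₁ z
  reflect x z f = cancel {x} {z} λ t hx → mono {top} {z} (f (holds⇒above x hx)) t holds-top

atom-minimal : (L : Poset c ℓ r) → ∀ {a b} → IsAtom L a → IsAtom L b →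
               Poset._≤_ L a b → Poset._≤_ L b a
atom-minimal L {a} {b} atom-a atom-b a≤b
  with DownsetTruthValues.realise L atom-a (Poset._≤_ L b a)
... | y , a≤y⇒b≤a , b≤a⇒a≤y =
  a≤y⇒b≤a (reflect (a , a≤b) (proj₁ y , trans (proj₂ y) a≤b) (λ b≤a → trans b≤a (b≤a⇒a≤y b≤a)))
  where
  open Poset L
  open DownsetTruthValues L atom-b using (reflect)

-- In a powerset, a subset U containing s whose elements all equal s is an
-- atom: a subset V ⊆ U is determined by the truth value "s ∈ V".
singleton-atom : (S : Setoid c ℓ) (U : Subset S p) (s : Setoid.Carrier S) →
                 proj₁ U s → (∀ x → proj₁ U x → Setoid._≈_ S x s) →
                 OrderIsomorphic (↓ (Pow S p) U) (Ω p)
singleton-atom {c = c} {ℓ = ℓ} {p = p} S U s s∈U only-s = χ , record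
  { isOrderMonomorphism = record
    { isOrderHomomorphism = record
      { cong = λ (V⊆W , W⊆V) → (λ _ → V⊆W s) , (λ _ → W⊆V s)
      ; mono = λ V⊆W _ → V⊆W s }
    ; injective = λ {V} {W} (s∈V⇒s∈W , s∈W⇒s∈V) →
                  χ-cancel V W s∈V⇒s∈W , χ-cancel W V s∈W⇒s∈V
    ; cancel = λ {V} {W} → χ-cancel V W }
  ; surjective = λ P → (restrict P , λ _ (x∈U , _) → x∈U)
                     , λ (V⊆ , ⊆V) → (λ _ s∈V → proj₂ (V⊆ s s∈V))
                                   , (λ _ Pt → ⊆V s (s∈U , Pt)) }
  where
  open Setoid S

  Below : Set (c ⊔ ℓ ⊔ Level.suc p)
  Below = Σ (Subset S p) (λ V → Incl S p V U)

  χ : Below → Subset 𝟙 p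
  χ V = (λ _ → proj₁ (proj₁ V) s) , λ _ u → u

  χ-cancel : (V W : Below) → Incl 𝟙 p (χ V) (χ W) → Incl S p (proj₁ V) (proj₁ W)
  χ-cancel ((V , V-resp) , V⊆U) ((W , W-resp) , _) s∈V⇒s∈W x x∈V =
    W-resp (sym (only-s x (V⊆U x x∈V))) (s∈V⇒s∈W tt (V-resp (only-s x (V⊆U x x∈V)) x∈V))

  restrict : Subset 𝟙 p → Subset S p
  restrict P = (λ x → proj₁ U x × proj₁ P tt) , λ x≈y (x∈U , Pt) → proj₂ U x≈y x∈U , Pt

module _ {P : Poset c ℓ r} {Q : Poset c′ ℓ′ r′}
         (ψ : Poset.Carrier P → Poset.Carrier Q)
         (ψ-iso : IsOrderIsomorphism (Poset._≈_ P) (Poset._≈_ Q) (Poset._≤_ P) (Poset._≤_ Q) ψ)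
  where
  private
    module P = Poset P
    module Q = Poset Q
  open IsOrderIsomorphism ψ-iso

  restrict-iso : (a : P.Carrier) → OrderIsomorphic (↓ P a) (↓ Q (ψ a))
  restrict-iso a = (λ (x , x≤a) → ψ x , mono x≤a) , record
    { isOrderMonomorphism = record
      { isOrderHomomorphism = record { cong = cong ; mono = mono }
      ; injective = injective
      ; cancel = cancel }
    ; surjective = λ (y , y≤ψa) → preimage y y≤ψa }
    where
    preimage : ∀ y → y Q.≤ ψ a →
               Σ (Σ P.Carrier (λ x → x P.≤ a))
                 (λ x → ∀ {z} → proj₁ z P.≈ proj₁ x → ψ (proj₁ z) Q.≈ y)
    preimage y y≤ψa with surjective y
    ... | x , ψx≈y = (x , cancel (Q.trans (Q.reflexive (ψx≈y P.Eq.refl)) y≤ψa)) , ψx≈y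

  atom-reflected : ∀ a → OrderIsomorphic (↓ Q (ψ a)) (Ω p) → OrderIsomorphic (↓ P a) (Ω p)
  atom-reflected {p = p} a (χ , χ-iso) =
    let (ρ , ρ-iso) = restrict-iso a
    in (λ x → χ (ρ x))
     , Compose.isOrderIsomorphism (λ {U V W} → Poset.Eq.trans (Ω p) {U} {V} {W}) ρ-iso χ-iso

module _ (L : Poset c ℓ r) where
  open Poset L

  Atom : Set (c ⊔ ℓ ⊔ Level.suc r)
  Atom = Setoid.Carrier (Atoms L)

  atomsBelow : Carrier → Subset (Atoms L) r
  atomsBelow x = (λ A → proj₁ A ≤ x) , λ A≈B A≤x → trans (reflexive (Eq.sym A≈B)) A≤x

  powerset⇒atomic : OrderIsomorphic L (Pow (Atoms L) r) → Atomic L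
  powerset⇒atomic (ψ , ψ-iso) x = (λ a (_ , a≤x) → a≤x) , least
    where
    open IsOrderIsomorphism ψ-iso

    singleton-preimage : (C : Atom) → Σ Carrier λ z → IsAtom L z × proj₁ (ψ z) C
                                       × (∀ D → proj₁ (ψ z) D → proj₁ D ≈ proj₁ C)
    singleton-preimage C with surjective (atomsBelow (proj₁ C))
    ... | z , ψ≈↓C = z , z-atom , C∈ψz , only-C
      where
      ψz≈↓C : SameElems (Atoms L) r (ψ z) (atomsBelow (proj₁ C))
      ψz≈↓C = ψ≈↓C {z} Eq.refl
      C∈ψz : proj₁ (ψ z) C
      C∈ψz = proj₂ ψz≈↓C C refl
      only-C : ∀ D → proj₁ (ψ z) D → proj₁ D ≈ proj₁ C
      only-C D D∈ψz = let D≤C = proj₁ ψz≈↓C D D∈ψz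
                      in antisym D≤C (atom-minimal L (proj₂ D) (proj₂ C) D≤C)
      z-atom : IsAtom L z
      z-atom = atom-reflected {P = L} {Q = Pow (Atoms L) r} ψ ψ-iso z
                 (singleton-atom (Atoms L) (ψ z) C C∈ψz only-C)

    least : ∀ y → (∀ a → IsAtom L a × a ≤ x → a ≤ y) → x ≤ y
    least y bound = cancel λ C C∈ψx →
      let (z , z-atom , C∈ψz , only-C) = singleton-preimage C
          z≤x = cancel λ D D∈ψz → proj₂ (ψ x) (Eq.sym (only-C D D∈ψz)) C∈ψx
      in mono (bound z (z-atom , z≤x)) C C∈ψz

module _ (L : Poset c ℓ r) (frame : IsFrame L) where
  open Poset L
  open IsFrame frame

  joinOf : Subset (Atoms L) r → Carrier
  joinOf U = ⋁ {I = Σ (Atom L) (proj₁ U)} (λ B → proj₁ (proj₁ B))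

  -- An atom A below ⋁U belongs to U: A = A ∧ ⋁U = ⋁_{B ∈ U} (A ∧ B) by
  -- distributivity, and each A ∧ B lies below the element of ↓A that
  -- realises the truth value "A ∈ U".
  atom-below-join : (U : Subset (Atoms L) r) (A : Atom L) → proj₁ A ≤ joinOf U → proj₁ U A
  atom-below-join U A@(a , atom-a) a≤⋁U with DownsetTruthValues.realise L atom-a (proj₁ U A)
  ... | (y , y≤a) , a≤y⇒A∈U , A∈U⇒a≤y = a≤y⇒A∈U (begin
      a                                  ≤⟨ ∧-glb _ _ _ refl a≤⋁U ⟩
      a ∧ joinOf U                       ≈⟨ distrib a _ ⟩
      ⋁ (λ B → a ∧ proj₁ (proj₁ B))      ≤⟨ ⋁-least _ y meet-below ⟩
      y                                  ∎)
    where
    open DownsetTruthValues L atom-a using (reflect)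
    open import Relation.Binary.Reasoning.PartialOrder L

    meet-below : (B : Σ (Atom L) (proj₁ U)) → a ∧ proj₁ (proj₁ B) ≤ y
    meet-below ((b , atom-b) , B∈U) = reflect (a ∧ b , ∧-lb₁ a b) (y , y≤a) λ a≤a∧b →
      let a≤b = trans a≤a∧b (∧-lb₂ a b)
          b≈a = antisym (atom-minimal L atom-a atom-b a≤b) a≤b
      in A∈U⇒a≤y (proj₂ U b≈a B∈U)

  atomic⇒powerset : Atomic L → OrderIsomorphic L (Pow (Atoms L) r)
  atomic⇒powerset atomic = atomsBelow L , record
    { isOrderMonomorphism = record
      { isOrderHomomorphism = record
        { cong = λ x≈y → (λ _ A≤x → trans A≤x (reflexive x≈y))
                       , (λ _ A≤y → trans A≤y (reflexive (Eq.sym x≈y)))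
        ; mono = λ x≤y _ A≤x → trans A≤x x≤y }
      ; injective = λ (x⊆y , y⊆x) → antisym (below-cancel x⊆y) (below-cancel y⊆x)
      ; cancel = below-cancel }
    ; surjective = λ U → joinOf U , λ z≈⋁U →
        (λ A A≤z → atom-below-join U A (trans A≤z (reflexive z≈⋁U)))
      , (λ A A∈U → trans (⋁-ub _ (A , A∈U)) (reflexive (Eq.sym z≈⋁U))) }
    where
    below-cancel : ∀ {x y} → Incl (Atoms L) r (atomsBelow L x) (atomsBelow L y) → x ≤ y
    below-cancel {x} {y} x⊆y = proj₂ (atomic x) y λ a (atom-a , a≤x) → x⊆y (a , atom-a) a≤x

proposition1p2 : ∀ {c ℓ r : Level} (L : Poset c ℓ r) → IsFrame L
    → Atomic L ⇔ OrderIsomorphic L (Pow (Atoms L) r)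
proposition1p2 L frame = mk⇔ (atomic⇒powerset L frame) (powerset⇒atomic L)
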